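{- Let $U$ be a universe of separations and let $(A_i\mid i\in I)$ be a finite collection of non-empty finite subsets of $U$ that splinters hierarchically with respect to a partial order $\preccurlyeq$ on $I$. If $K\subseteq I$ is an antichain in $\preccurlyeq$, then the set of extremal elements of $\bigcup_{k\in K}A_k$ is nested.
   Context: A separation system is a poset $\vec S$ with an order-reversing involution $\vec s\mapsto\overleftarrow s$; $s=\{\vec s,\overleftarrow s\}$; for a set $A$ of unoriented separations, $\vec A$ is the set of all orientations of its elements. A universe is a separation system which is a lattice with join $\vee$, meet $\wedge$. Separations $r,s$ are nested if they have orientations with $\vec r\le\vec s$, and cross otherwise. The corner separations of $r,s$ are the $\vec r\vee\vec s$ over all choices of orientations. An element $a\in A$ is extremal in $A$ if some orientation $\vec a$ of $a$ is a maximal element of $\vec A$. Corner separations $c_1,c_2$ of $r,s$ are from different sides of $r$ if, for orientations with $\vec c_1=\vec r\wedge\vec s$, there is an orientation $\vec c_2$ with $\vec c_2=\overleftarrow r\wedge\vec s$ or $\vec c_2=\overleftarrow r\wedge\overleftarrow s$. Write $i\prec j$ if $i\preccurlyeq j$, $i\ne j$. The collection splinters hierarchically w.r.t. $\preccurlyeq$ if for all $a_i\in A_i$, $a_j\in A_j$: (1) if $i\prec j$, either some corner separation of $a_i,a_j$ lies in $A_j$, or two corner separations of $a_i,a_j$ from different sides of $a_i$ lie in $A_i$; (2) if neither $i\prec j$ nor $j\prec i$, there are $k\in\{i,j\}$ and corner separations $c_1,c_2$ of $a_i,a_j$ from different sides of $a_k$ with $c_1\in A_k$ and $c_2\in A_i\cup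 A_j$. -}

module Defs where

open import Level using (Level; _⊔_; suc)
open import Data.Fin using (Fin)
open import Data.Nat using (ℕ)
open import Data.List using (List; [])
open import Data.List.Membership.Propositional using (_∈_)
open import Data.Product using (Σ; ∃; _×_; _,_)
open import Data.Sum using (_⊎_)
open import Relation.Binary.PropositionalEquality using (_≡_; _≢_)
open import Relation.Binary.Structures using (IsPartialOrder)
open import Relation.Binary.Lattice.Structures using (IsLattice)
open import Relation.Unary using (Pred)
import Data.List
open import Data.Empty using (⊥)

record Universe (a ℓ : Level) : Set (suc (a ⊔ ℓ)) where
  field
    Carrier     : Set a
    _≤_         : Carrier → Carrier → Set ℓ
    _*          : Carrier → Carrier
    _∨_         : Carrier → Carrier → Carrier
    _∧_         : Carrier → Carrier → Carrier
    isLattice   : IsLattice _≡_ _≤_ _∨_ _∧_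
    involutive  : ∀ s → (s *) * ≡ s
    reversing   : ∀ {r s} → r ≤ s → (s *) ≤ (r *)

module _ {a ℓ : Level} (U : Universe a ℓ) where
  open Universe U

  -- An unoriented separation s = {s , s*} is represented by either orientation.
  -- A finite set A of unoriented separations is given by a list of orientations
  -- (one or both per separation); the oriented set vec A is then:
  _∈→_ : Carrier → List Carrier → Set a
  s ∈→ A = s ∈ A ⊎ (s *) ∈ A

  IsOrientation : Carrier → Carrier → Set a
  IsOrientation s s' = s' ≡ s ⊎ s' ≡ s *

  Nested : Carrier → Carrier → Set (a ⊔ ℓ)
  Nested r s = Σ Carrier λ r' → Σ Carrier λ s' →
    IsOrientation r r' × IsOrientation s s' × r' ≤ s'

  CornerIn : Carrier → Carrier → List Carrier → Set a
  CornerIn r s A = Σ Carrier λ r' → Σ Carrier λ s' →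
    IsOrientation r r' × IsOrientation s s' × (r' ∨ s') ∈→ A

  DiffSides : Carrier → Carrier → List Carrier → List Carrier → Set a
  DiffSides r s B C = Σ Carrier λ r' → Σ Carrier λ s' → Σ Carrier λ s'' →
    IsOrientation r r' × IsOrientation s s' × IsOrientation s s'' ×
    (r' ∧ s') ∈→ B × ((r' *) ∧ s'') ∈→ C

  SplintersHierarchically : {n : ℕ} {ℓ' : Level} →
    (Fin n → List Carrier) → (Fin n → Fin n → Set ℓ') → Set (a ⊔ ℓ')
  SplintersHierarchically {n} A _≼_ =
    ∀ (i j : Fin n) (ai aj : Carrier) → ai ∈→ A i → aj ∈→ A j →
      (((i ≼ j) × (i ≢ j)) →
          CornerIn ai aj (A j) ⊎ DiffSides ai aj (A i) (A i))
    × ((((i ≼ j) × (i ≢ j)) → ⊥) → (((j ≼ i) × (j ≢ i)) → ⊥) →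
          DiffSides ai aj (A i) (A i Data.List.++ A j)
        ⊎ DiffSides aj ai (A j) (A i Data.List.++ A j))

  InUnion : {n : ℕ} {ℓk : Level} → (Fin n → List Carrier) → Pred (Fin n) ℓk →
    Carrier → Set (a ⊔ ℓk)
  InUnion {n} A K s = Σ (Fin n) λ k → K k × s ∈→ A k

  Extremal : {ℓp : Level} → Pred Carrier ℓp → Carrier → Set (a ⊔ ℓ ⊔ ℓp)
  Extremal P s = P s × (Σ Carrier λ s' → IsOrientation s s' ×
    (∀ t → P t → s' ≤ t → s' ≡ t))

module Submission where

-- Let P be a set of oriented separations closed under _* and let
-- x̂ be a maximal element of P.  If a corner x̂* ∧ y' (y' an orientation of y)
-- lies in P then so does its inverse, which lies above x̂; maximality forces
-- x̂ = (x̂* ∧ y')*, i.e. x̂* = x̂* ∧ y' ≤ y', so x and y are nested.  Two corner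
-- separations of x and y from different sides of x always include one of the
-- form x̂* ∧ y', whichever orientation x̂ of x we start from.  Hence: if such
-- a pair of corners lies in P, then x and y are nested.
--
-- For the theorem take P = vec(⋃_{k ∈ K} A_k), which is closed under _* and
-- contains A_i and A_i ∪ A_j for i, j ∈ K.  Extremal r and s come from some
-- A_i and A_j with i, j ∈ K; since K is an antichain, i and j are
-- incomparable, so clause (2) of hierarchical splintering supplies corners
-- from different sides of r or of s inside P, and the above applies to the
-- extremal one of the two.  Nestedness is symmetric, which covers both cases.

open import Defs
open import Level using (Level; _⊔_)
open import Data.Nat using (ℕ)
open import Data.Fin using (Fin)
open import Data.List using (List; []; _++_)
open import Data.List.Membership.Propositional using (_∈_)
open import Data.List.Membership.Propositional.Properties using (∈-++⁻)
open import Data.Product using (_×_; _,_; Σ; proj₁; proj₂)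
open import Data.Sum using (_⊎_; inj₁; inj₂)
open import Data.Empty using (⊥)
open import Relation.Binary.PropositionalEquality
  using (_≡_; _≢_; refl; sym; trans; subst; cong)
open import Relation.Binary.Structures using (IsPartialOrder)
open import Relation.Binary.Lattice.Structures using (IsLattice)
open import Relation.Unary using (Pred)

module Separations {a ℓ : Level} (U : Universe a ℓ) where
  open Universe U
  open IsLattice isLattice using (infimum)

  ∧-lowerˡ : ∀ x y → (x ∧ y) ≤ x
  ∧-lowerˡ x y = proj₁ (infimum x y)

  ∧-lowerʳ : ∀ x y → (x ∧ y) ≤ y
  ∧-lowerʳ x y = proj₁ (proj₂ (infimum x y))

  orientation-* : ∀ {x x'} → IsOrientation U x x' → IsOrientation U x (x' *)
  orientation-* (inj₁ refl) = inj₂ refl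
  orientation-* {x} (inj₂ refl) = inj₁ (involutive x)

  orientations-compare : ∀ {x x' x''} → IsOrientation U x x' → IsOrientation U x x'' →
    x' ≡ x'' ⊎ (x' *) ≡ x''
  orientations-compare (inj₁ p) (inj₁ q) = inj₁ (trans p (sym q))
  orientations-compare {x} (inj₂ p) (inj₁ q) =
    inj₂ (trans (cong _* p) (trans (involutive x) (sym q)))
  orientations-compare (inj₁ p) (inj₂ q) = inj₂ (trans (cong _* p) (sym q))
  orientations-compare (inj₂ p) (inj₂ q) = inj₁ (trans p (sym q))

  nested-sym : ∀ {r s} → Nested U r s → Nested U s r
  nested-sym (r' , s' , or' , os' , r'≤s') =
    s' * , r' * , orientation-* os' , orientation-* or' , reversing r'≤s'

  ClosedUnder* : ∀ {ℓp} → Pred Carrier ℓp → Set (a ⊔ ℓp)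
  ClosedUnder* P = ∀ c → P c → P (c *)

  MaximalIn : ∀ {ℓp} → Pred Carrier ℓp → Carrier → Set (a ⊔ ℓ ⊔ ℓp)
  MaximalIn P x̂ = ∀ t → P t → x̂ ≤ t → x̂ ≡ t

  Covers : ∀ {ℓp} → Pred Carrier ℓp → List Carrier → Set (a ⊔ ℓp)
  Covers P B = ∀ c → _∈→_ U c B → P c

  -- Corner lemma: a corner x̂* ∧ y' in a *-closed P with x̂ maximal in P
  -- collapses to x̂*, so x̂* ≤ y'.
  maximal-below-corner : ∀ {ℓp} {P : Pred Carrier ℓp} → ClosedUnder* P →
    ∀ {x̂} → MaximalIn P x̂ → ∀ y' → P ((x̂ *) ∧ y') → (x̂ *) ≤ y'
  maximal-below-corner {P = P} closed {x̂} max y' corner∈P =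
    subst (_≤ y') (sym x̂*≡corner) (∧-lowerʳ (x̂ *) y')
    where
    corner = (x̂ *) ∧ y'
    x̂≤corner* : x̂ ≤ (corner *)
    x̂≤corner* = subst (_≤ (corner *)) (involutive x̂) (reversing (∧-lowerˡ (x̂ *) y'))
    x̂*≡corner : (x̂ *) ≡ corner
    x̂*≡corner = trans (cong _* (max (corner *) (closed corner corner∈P) x̂≤corner*))
                      (involutive corner)

  corner-opposite : ∀ {x y B C x̂} → IsOrientation U x x̂ → DiffSides U x y B C →
    Σ Carrier λ y' → IsOrientation U y y' × (_∈→_ U ((x̂ *) ∧ y') B ⊎ _∈→_ U ((x̂ *) ∧ y') C)
  corner-opposite {x̂ = x̂} ox̂ (x' , y' , y'' , ox' , oy' , oy'' , c₁∈B , c₂∈C)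
    with orientations-compare ox̂ ox'
  ... | inj₁ x̂≡x' = y'' , oy'' , inj₂ (subst (λ z → _∈→_ U ((z *) ∧ y'') _) (sym x̂≡x') c₂∈C)
  ... | inj₂ x̂*≡x' = y' , oy' , inj₁ (subst (λ z → _∈→_ U (z ∧ y') _) (sym x̂*≡x') c₁∈B)

  diffSides⇒nested : ∀ {ℓp} {P : Pred Carrier ℓp} → ClosedUnder* P →
    ∀ {x y B C x̂} → IsOrientation U x x̂ → MaximalIn P x̂ →
    Covers P B → Covers P C → DiffSides U x y B C → Nested U x y
  diffSides⇒nested {P = P} closed {B = B} {C} {x̂} ox̂ max B⊆P C⊆P sides
    with corner-opposite ox̂ sides
  ... | y' , oy' , corner∈ = x̂ * , y' , orientation-* ox̂ , oy' ,
    maximal-below-corner closed max y' (either-side corner∈)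
    where
    either-side : ∀ {c} → _∈→_ U c B ⊎ _∈→_ U c C → P c
    either-side (inj₁ c∈B) = B⊆P _ c∈B
    either-side (inj₂ c∈C) = C⊆P _ c∈C

  module Union {n : ℕ} {ℓk : Level} (A : Fin n → List Carrier) (K : Pred (Fin n) ℓk) where

    inUnion-closed : ClosedUnder* (InUnion U A K)
    inUnion-closed c (k , Kk , inj₁ c∈A) =
      k , Kk , inj₂ (subst (_∈ A k) (sym (involutive c)) c∈A)
    inUnion-closed c (k , Kk , inj₂ c*∈A) = k , Kk , inj₁ c*∈A

    inUnion-covers : ∀ {k} → K k → Covers (InUnion U A K) (A k)
    inUnion-covers {k} Kk c c∈A = k , Kk , c∈A

    inUnion-covers-++ : ∀ {k l} → K k → K l → Covers (InUnion U A K) (A k ++ A l)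
    inUnion-covers-++ {k} {l} Kk Kl c (inj₁ c∈) with ∈-++⁻ (A k) c∈
    ... | inj₁ c∈Ak = k , Kk , inj₁ c∈Ak
    ... | inj₂ c∈Al = l , Kl , inj₁ c∈Al
    inUnion-covers-++ {k} {l} Kk Kl c (inj₂ c*∈) with ∈-++⁻ (A k) c*∈
    ... | inj₁ c*∈Ak = k , Kk , inj₂ c*∈Ak
    ... | inj₂ c*∈Al = l , Kl , inj₂ c*∈Al

antichain-not-strict : ∀ {n ℓ' ℓk} {_≼_ : Fin n → Fin n → Set ℓ'} {K : Pred (Fin n) ℓk} →
  (∀ k k' → K k → K k' → k ≼ k' → k ≡ k') →
  ∀ {i j} → K i → K j → (i ≼ j) × (i ≢ j) → ⊥
antichain-not-strict anti Ki Kj (i≼j , i≢j) = i≢j (anti _ _ Ki Kj i≼j)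

lemma15 : ∀ {a ℓ ℓ' ℓk : Level} (U : Universe a ℓ) (n : ℕ)
    (A : Fin n → List (Universe.Carrier U))
    (_≼_ : Fin n → Fin n → Set ℓ') →
    IsPartialOrder _≡_ _≼_ →
    (∀ i → A i ≢ []) →
    SplintersHierarchically U A _≼_ →
    (K : Pred (Fin n) ℓk) →
    (∀ k k' → K k → K k' → k ≼ k' → k ≡ k') →
    ∀ r s → Extremal U (InUnion U A K) r → Extremal U (InUnion U A K) s →
      Nested U r s
lemma15 U n A _≼_ _ _ splinters K anti r s
  ((i , Ki , r∈Ai) , r̂ , or̂ , r̂-max) ((j , Kj , s∈Aj) , ŝ , oŝ , ŝ-max)
  with proj₂ (splinters i j r s r∈Ai s∈Aj)
             (antichain-not-strict anti Ki Kj) (antichain-not-strict anti Kj Ki)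
... | inj₁ sides-of-r =
  diffSides⇒nested inUnion-closed or̂ r̂-max
    (inUnion-covers Ki) (inUnion-covers-++ Ki Kj) sides-of-r
  where open Separations U; open Union A K
... | inj₂ sides-of-s = nested-sym
  (diffSides⇒nested inUnion-closed oŝ ŝ-max
    (inUnion-covers Kj) (inUnion-covers-++ Ki Kj) sides-of-s)
  where open Separations U; open Union A K
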